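{- Let $f(x_1,\dots,x_r)=\bigvee_{j=1}^{m}\bigwedge_{i\in C_j}x_i$ be a Boolean function in disjunctive normal form using only $\vee$ and $\wedge$ (no negations), where $C_1,\dots,C_m$ are nonempty subsets of $\{1,\dots,r\}$, and let $g_f(\alpha_1,\dots,\alpha_r)=\sum_{j=1}^{m}\prod_{i\in C_j}\alpha_i$ (obtained from $f$ by replacing $x_i$ by $\alpha_i$, $\vee$ by $+$ and $\wedge$ by $\times$). Then for every graph $\mathcal{G}$, the $f$-intersection number of $\mathcal{G}$ is at least the optimal value of the integer program: minimize $\sum_{i=1}^r\alpha_i$ subject to $g_f(\alpha_1,\dots,\alpha_r)\ge\theta_1(\mathcal{G})$ and $\alpha_i\in\mathbb{Z}$, $\alpha_i\ge1$ for all $i\in\{1,\dots,r\}$.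
   Context: Graphs are finite, simple and undirected. For $f$ as in the claim and a graph $\mathcal{G}=(\mathcal{V},\mathcal{E})$, an $(\alpha_1\mid\cdots\mid\alpha_r)$-$f$-intersection representation of $\mathcal{G}$ consists of pairwise disjoint nonempty finite feature sets $\mathcal{A}^1,\dots,\mathcal{A}^r$ with $|\mathcal{A}^i|=\alpha_i$ and an assignment to each vertex $v$ of subsets $A^i_v\subseteq\mathcal{A}^i$ ($i=1,\dots,r$, possibly empty) such that for all distinct $u,v\in\mathcal{V}$: $(u,v)\in\mathcal{E}$ iff $f(x_1,\dots,x_r)$ is true when $x_i$ is set to true exactly when $A^i_u\cap A^i_v\ne\varnothing$. The $f$-intersection number of $\mathcal{G}$ is the minimum of $\sum_i\alpha_i$ over all such representations. The intersection number $\theta_1(\mathcal{G})$ is the minimum size of a nonempty finite set $F$ for which there exist subsets $S_v\subseteq F$ (possibly empty) such that distinct $u,v$ are adjacent iff $S_u\cap S_v\neq\varnothing$; for a graph with at least one edge this equals the minimum number of cliques needed to cover all edges, and for an edgeless graph it equals $1$. -}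

module Defs where

open import Data.Nat using (ℕ; zero; suc; _+_; _*_; _≤_)
open import Data.Bool using (Bool; true; false; if_then_else_)
open import Data.Fin using (Fin; zero; suc)
open import Data.Fin.Subset using (Subset; _∈_; Nonempty)
open import Data.Vec using ([]; _∷_)
open import Data.List using (List)
open import Data.List.Relation.Unary.Any using (Any)
open import Data.List.Relation.Unary.All using (All)
open import Data.Product using (Σ; _×_; ∃; _,_)
open import Relation.Binary.PropositionalEquality using (_≡_; _≢_)
open import Relation.Nullary using (¬_)
open import Function.Bundles using (_⇔_)

record Graph (n : ℕ) : Set where
  field
    adj   : Fin n → Fin n → Bool
    sym   : ∀ u v → adj u v ≡ adj v u
    irrefl : ∀ v → adj v v ≡ false
open Graph public

∑ : (r : ℕ) → (Fin r → ℕ) → ℕ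
∑ zero    α = 0
∑ (suc r) α = α zero + ∑ r (λ i → α (suc i))

∏∈ : {r : ℕ} → Subset r → (Fin r → ℕ) → ℕ
∏∈ []          α = 1
∏∈ (b ∷ s) α = (if b then α zero else 1) * ∏∈ s (λ i → α (suc i))

DNF : ℕ → Set
DNF r = List (Subset r)

evalDNF : {r : ℕ} → DNF r → (Fin r → Set) → Set
evalDNF C x = Any (λ Cj → ∀ i → i ∈ Cj → x i) C

gf : {r : ℕ} → DNF r → (Fin r → ℕ) → ℕ
gf List.[]       α = 0
gf (Cj List.∷ C) α = ∏∈ Cj α + gf C α

Meets : {k : ℕ} → Subset k → Subset k → Set
Meets A B = ∃ λ x → x ∈ A × x ∈ B

-- (α₁|…|α_r)-f-intersection representation. Feature set 𝒜^i is Fin (α i)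
-- (the 𝒜^i are taken as disjoint copies); |𝒜^i| = α i ≥ 1.
record FRep {n : ℕ} (r : ℕ) (C : DNF r) (G : Graph n) (α : Fin r → ℕ) : Set where
  field
    nonempty : ∀ i → 1 ≤ α i
    A        : (i : Fin r) → Fin n → Subset (α i)
    correct  : ∀ u v → u ≢ v →
               (adj G u v ≡ true ⇔ evalDNF C (λ i → Meets (A i u) (A i v)))

record IntRep {n : ℕ} (G : Graph n) (k : ℕ) : Set where
  field
    nonempty : 1 ≤ k
    S        : Fin n → Subset k
    correct  : ∀ u v → u ≢ v → (adj G u v ≡ true ⇔ Meets (S u) (S v))

IsIntersectionNumber : {n : ℕ} → Graph n → ℕ → Set
IsIntersectionNumber G θ = IntRep G θ × (∀ k → IntRep G k → θ ≤ k)

Feasible : {r : ℕ} → DNF r → ℕ → (Fin r → ℕ) → Set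
Feasible C θ β = (∀ i → 1 ≤ β i) × θ ≤ gf C β

IsIPOptimum : (r : ℕ) → DNF r → ℕ → ℕ → Set
IsIPOptimum r C θ v =
  (Σ (Fin r → ℕ) λ β → Feasible C θ β × ∑ r β ≡ v) ×
  (∀ β → Feasible C θ β → v ≤ ∑ r β)

module Submission where

-- Let the sets A^i_u (of sizes α_i) form an
-- f-intersection representation of G.  Take as new feature set the
-- disjoint union, over the clauses C_j, of the products ∏_{i ∈ C_j} 𝒜^i;
-- it has exactly g_f(α) elements.  Give vertex u the features
-- S_u = ⋃_j ∏_{i ∈ C_j} A^i_u.  Two vertices share a feature iff for some
-- clause C_j they share a point of every factor, i.e. iff f is true on the
-- intersection pattern of u and v, i.e. iff they are adjacent.  So G has an
-- ordinary intersection representation on g_f(α) features, hence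
-- θ₁(G) ≤ g_f(α): the vector α is feasible for the integer program, and
-- the optimum v is at most ∑ α_i.

open import Defs
open import Data.Nat using (ℕ; _≤_)
open import Data.Fin using (Fin)
open import Data.Fin.Subset using (Nonempty)
open import Data.List using (List; [])
open import Data.List.Relation.Unary.All using (All)
open import Relation.Binary.PropositionalEquality using (_≢_)

open import Level using (0ℓ)
open import Data.Nat using (suc; _+_; _*_)
open import Data.Nat.Properties using (*-mono-≤; ≤-trans; m≤m+n; ≤-refl)
open import Data.Empty using (⊥-elim)
open import Data.Bool using (Bool; true; false; _∧_)
open import Data.Fin using (zero; suc; quotient; remainder; combine; splitAt; _↑ˡ_; _↑ʳ_)
open import Data.Fin.Properties using (remQuot-combine)
open import Data.Fin.Subset using (Subset; _∈_; ⊤)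
open import Data.Fin.Subset.Properties using (∈⊤)
open import Data.List using (_∷_)
open import Data.Vec using ([]; _∷_; _++_; lookup; tabulate; here; there)
open import Data.Vec.Properties
  using ([]=⇒lookup; lookup⇒[]=; lookup∘tabulate; lookup-splitAt; lookup-++ˡ; lookup-++ʳ)
open import Data.List.Relation.Unary.Any.Properties using (∷↔)
open import Data.Product using (_×_; _,_; proj₁; proj₂)
open import Data.Product.Function.NonDependent.Propositional using (_×-⇔_)
open import Data.Sum using (_⊎_; inj₁; inj₂; [_,_]′)
open import Data.Sum.Function.Propositional using (_⊎-⇔_)
open import Function using (_∘_)
open import Function.Bundles using (_⇔_; mk⇔; Equivalence)
open import Function.Properties.Equivalence using (⇔-setoid)
  renaming (sym to ⇔-sym; refl to refl-⇔; trans to ⇔-trans)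
open import Function.Properties.Inverse using (↔⇒⇔)
open import Relation.Binary.PropositionalEquality using (_≡_; refl; trans; subst)
  renaming (sym to ≡-sym)
open import Relation.Binary.Reasoning.Setoid (⇔-setoid 0ℓ)

private
  variable
    a b k n r : ℕ

∈⇔lookup : {x : Fin k} {p : Subset k} → x ∈ p ⇔ lookup p x ≡ true
∈⇔lookup {x = x} {p} = mk⇔ []=⇒lookup (lookup⇒[]= x p)

∧≡true⇔ : {c d : Bool} → c ∧ d ≡ true ⇔ (c ≡ true × d ≡ true)
∧≡true⇔ {true}  = mk⇔ (λ d≡true → refl , d≡true) proj₂
∧≡true⇔ {false} = mk⇔ (λ ()) (λ ())

-- The product A ⊗ B ⊆ Fin (a * b) of A ⊆ Fin a and B ⊆ Fin b, using
-- Fin (a * b) ≅ Fin a × Fin b (quotient/remainder, inverse to combine).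
_⊗_ : Subset a → Subset b → Subset (a * b)
_⊗_ {a} {b} A B = tabulate λ x → lookup A (quotient {a} b x) ∧ lookup B (remainder {a} b x)

∈⊗⇔ : {A : Subset a} {B : Subset b} (x : Fin (a * b)) →
      x ∈ A ⊗ B ⇔ (quotient {a} b x ∈ A × remainder {a} b x ∈ B)
∈⊗⇔ {a} {b} {A} {B} x = begin
  x ∈ A ⊗ B                                      ≈⟨ ∈⇔lookup ⟩
  lookup (A ⊗ B) x ≡ true                        ≈⟨ ≡true-cong (lookup∘tabulate _ x) ⟩
  lookup A i ∧ lookup B j ≡ true                 ≈⟨ ∧≡true⇔ ⟩
  (lookup A i ≡ true × lookup B j ≡ true)        ≈⟨ ⇔-sym (∈⇔lookup ×-⇔ ∈⇔lookup) ⟩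
  (i ∈ A × j ∈ B)                                ∎
  where
  i : Fin a
  i = quotient {a} b x
  j : Fin b
  j = remainder {a} b x
  ≡true-cong : {c d : Bool} → c ≡ d → (c ≡ true) ⇔ (d ≡ true)
  ≡true-cong refl = refl-⇔

combine-∈⊗ : {A : Subset a} {B : Subset b} {i : Fin a} {j : Fin b} →
             i ∈ A → j ∈ B → combine i j ∈ A ⊗ B
combine-∈⊗ {A = A} {B} {i} {j} i∈A j∈B =
  Equivalence.from (∈⊗⇔ (combine i j))
    (subst (λ p → proj₁ p ∈ A × proj₂ p ∈ B) (≡-sym (remQuot-combine i j)) (i∈A , j∈B))

Meets-⊗ : {A A′ : Subset a} {B B′ : Subset b} →
          Meets (A ⊗ B) (A′ ⊗ B′) ⇔ (Meets A A′ × Meets B B′)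
Meets-⊗ {A = A} {A′} {B} {B′} = mk⇔ split (λ { ((i , i∈A , i∈A′) , (j , j∈B , j∈B′)) →
  combine i j , combine-∈⊗ i∈A j∈B , combine-∈⊗ i∈A′ j∈B′ })
  where
  split : Meets (A ⊗ B) (A′ ⊗ B′) → Meets A A′ × Meets B B′
  split (x , x∈ , x∈′) =
    let p = Equivalence.to (∈⊗⇔ {A = A} {B} x) x∈
        p′ = Equivalence.to (∈⊗⇔ {A = A′} {B′} x) x∈′
    in (_ , proj₁ p , proj₁ p′) , (_ , proj₂ p , proj₂ p′)

↑ˡ-∈++ : {A : Subset a} (B : Subset b) {i : Fin a} → i ∈ A → i ↑ˡ b ∈ A ++ B
↑ˡ-∈++ {A = A} B {i} i∈A =
  lookup⇒[]= (i ↑ˡ _) (A ++ B) (trans (lookup-++ˡ A B i) ([]=⇒lookup i∈A))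

↑ʳ-∈++ : (A : Subset a) {B : Subset b} {j : Fin b} → j ∈ B → a ↑ʳ j ∈ A ++ B
↑ʳ-∈++ {a} A {B} {j} j∈B =
  lookup⇒[]= (a ↑ʳ j) (A ++ B) (trans (lookup-++ʳ A B j) ([]=⇒lookup j∈B))

Meets-++ : {A A′ : Subset a} {B B′ : Subset b} →
           Meets (A ++ B) (A′ ++ B′) ⇔ (Meets A A′ ⊎ Meets B B′)
Meets-++ {a} {b} {A} {A′} {B} {B′} = mk⇔ split join
  where
  inPart : (A : Subset a) (B : Subset b) (x : Fin (a + b)) → x ∈ A ++ B →
           [ lookup A , lookup B ]′ (splitAt a x) ≡ true
  inPart A B x x∈ = trans (≡-sym (lookup-splitAt a A B x)) ([]=⇒lookup x∈)

  cases : (y : Fin a ⊎ Fin b) → [ lookup A , lookup B ]′ y ≡ true →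
          [ lookup A′ , lookup B′ ]′ y ≡ true → Meets A A′ ⊎ Meets B B′
  cases (inj₁ i) e e′ = inj₁ (i , lookup⇒[]= i A e , lookup⇒[]= i A′ e′)
  cases (inj₂ j) e e′ = inj₂ (j , lookup⇒[]= j B e , lookup⇒[]= j B′ e′)

  split : Meets (A ++ B) (A′ ++ B′) → Meets A A′ ⊎ Meets B B′
  split (x , x∈ , x∈′) = cases (splitAt a x) (inPart A B x x∈) (inPart A′ B′ x x∈′)

  join : Meets A A′ ⊎ Meets B B′ → Meets (A ++ B) (A′ ++ B′)
  join (inj₁ (i , i∈A , i∈A′)) = i ↑ˡ b , ↑ˡ-∈++ B i∈A , ↑ˡ-∈++ B′ i∈A′
  join (inj₂ (j , j∈B , j∈B′)) = a ↑ʳ j , ↑ʳ-∈++ A j∈B , ↑ʳ-∈++ A′ j∈B′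

∀∈-true : {s : Subset r} {P : Fin (suc r) → Set} →
          (∀ i → i ∈ true ∷ s → P i) ⇔ (P zero × (∀ i → i ∈ s → P (suc i)))
∀∈-true = mk⇔ (λ h → h zero here , λ i i∈s → h (suc i) (there i∈s))
              (λ { (h₀ , h) zero here → h₀ ; (h₀ , h) (suc i) (there i∈s) → h i i∈s })

∀∈-false : {s : Subset r} {P : Fin (suc r) → Set} →
           (∀ i → i ∈ false ∷ s → P i) ⇔ (∀ i → i ∈ s → P (suc i))
∀∈-false = mk⇔ (λ h i i∈s → h (suc i) (there i∈s))
               (λ { h (suc i) (there i∈s) → h i i∈s })

-- The features of one clause s: tuples (x_i)_{i ∈ s} with x_i ∈ B i,
-- encoded in Fin (∏_{i ∈ s} α i); a coordinate outside s contributes the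
-- trivial factor ⊤ ⊆ Fin 1.
clauseSet : {α : Fin r → ℕ} (s : Subset r) → ((i : Fin r) → Subset (α i)) → Subset (∏∈ s α)
clauseSet []          B = ⊤
clauseSet (true ∷ s)  B = B zero ⊗ clauseSet s (B ∘ suc)
clauseSet (false ∷ s) B = ⊤ {1} ⊗ clauseSet s (B ∘ suc)

Meets-clauseSet : {α : Fin r → ℕ} (s : Subset r) (Bu Bv : (i : Fin r) → Subset (α i)) →
                  Meets (clauseSet s Bu) (clauseSet s Bv) ⇔ (∀ i → i ∈ s → Meets (Bu i) (Bv i))
Meets-clauseSet [] Bu Bv = mk⇔ (λ _ ()) (λ _ → zero , ∈⊤ , ∈⊤)
Meets-clauseSet (true ∷ s) Bu Bv = begin
  Meets (Bu zero ⊗ clauseSet s (Bu ∘ suc)) (Bv zero ⊗ clauseSet s (Bv ∘ suc)) ≈⟨ Meets-⊗ ⟩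
  (Meets (Bu zero) (Bv zero) × Meets (clauseSet s (Bu ∘ suc)) (clauseSet s (Bv ∘ suc)))
    ≈⟨ refl-⇔ ×-⇔ Meets-clauseSet s (Bu ∘ suc) (Bv ∘ suc) ⟩
  (Meets (Bu zero) (Bv zero) × (∀ i → i ∈ s → Meets (Bu (suc i)) (Bv (suc i))))
    ≈⟨ ⇔-sym ∀∈-true ⟩
  (∀ i → i ∈ true ∷ s → Meets (Bu i) (Bv i)) ∎
Meets-clauseSet (false ∷ s) Bu Bv = begin
  Meets (⊤ {1} ⊗ clauseSet s (Bu ∘ suc)) (⊤ {1} ⊗ clauseSet s (Bv ∘ suc)) ≈⟨ Meets-⊗ ⟩
  (Meets {1} ⊤ ⊤ × Meets (clauseSet s (Bu ∘ suc)) (clauseSet s (Bv ∘ suc)))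
    ≈⟨ mk⇔ proj₂ (λ m → (zero , ∈⊤ , ∈⊤) , m) ⟩
  Meets (clauseSet s (Bu ∘ suc)) (clauseSet s (Bv ∘ suc))
    ≈⟨ Meets-clauseSet s (Bu ∘ suc) (Bv ∘ suc) ⟩
  (∀ i → i ∈ s → Meets (Bu (suc i)) (Bv (suc i)))
    ≈⟨ ⇔-sym ∀∈-false ⟩
  (∀ i → i ∈ false ∷ s → Meets (Bu i) (Bv i)) ∎

dnfSet : {α : Fin r → ℕ} (C : DNF r) → ((i : Fin r) → Subset (α i)) → Subset (gf C α)
dnfSet []      B = []
dnfSet (c ∷ C) B = clauseSet c B ++ dnfSet C B

Meets-dnfSet : {α : Fin r → ℕ} (C : DNF r) (Bu Bv : (i : Fin r) → Subset (α i)) →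
               Meets (dnfSet C Bu) (dnfSet C Bv) ⇔ evalDNF C (λ i → Meets (Bu i) (Bv i))
Meets-dnfSet []      Bu Bv = mk⇔ (λ { (() , _) }) (λ ())
Meets-dnfSet (c ∷ C) Bu Bv = begin
  Meets (clauseSet c Bu ++ dnfSet C Bu) (clauseSet c Bv ++ dnfSet C Bv) ≈⟨ Meets-++ ⟩
  (Meets (clauseSet c Bu) (clauseSet c Bv) ⊎ Meets (dnfSet C Bu) (dnfSet C Bv))
    ≈⟨ Meets-clauseSet c Bu Bv ⊎-⇔ Meets-dnfSet C Bu Bv ⟩
  ((∀ i → i ∈ c → Meets (Bu i) (Bv i)) ⊎ evalDNF C (λ i → Meets (Bu i) (Bv i)))
    ≈⟨ ↔⇒⇔ (∷↔ _) ⟩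
  evalDNF (c ∷ C) (λ i → Meets (Bu i) (Bv i)) ∎

∏∈-positive : {α : Fin r → ℕ} (s : Subset r) → (∀ i → 1 ≤ α i) → 1 ≤ ∏∈ s α
∏∈-positive []          α≥1 = ≤-refl
∏∈-positive (true ∷ s)  α≥1 = *-mono-≤ (α≥1 zero) (∏∈-positive s (α≥1 ∘ suc))
∏∈-positive (false ∷ s) α≥1 = *-mono-≤ (≤-refl {1}) (∏∈-positive s (α≥1 ∘ suc))

gf-positive : {α : Fin r → ℕ} (C : DNF r) → C ≢ [] → (∀ i → 1 ≤ α i) → 1 ≤ gf C α
gf-positive []      C≢[] α≥1 = ⊥-elim (C≢[] refl)
gf-positive (c ∷ C) C≢[] α≥1 = ≤-trans (∏∈-positive c α≥1) (m≤m+n _ _)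

intRep-from-fRep : {C : DNF r} → C ≢ [] → {G : Graph n} {α : Fin r → ℕ} →
                   FRep r C G α → IntRep G (gf C α)
intRep-from-fRep {C = C} C≢[] rep = record
  { nonempty = gf-positive C C≢[] (FRep.nonempty rep)
  ; S        = λ u → dnfSet C (λ i → FRep.A rep i u)
  ; correct  = λ u v u≢v →
      ⇔-trans (FRep.correct rep u v u≢v)
              (⇔-sym (Meets-dnfSet C (λ i → FRep.A rep i u) (λ i → FRep.A rep i v)))
  }

proposition6 : (r : ℕ) (C : DNF r) → C ≢ [] → All Nonempty C →
    {n : ℕ} (G : Graph n) (θ : ℕ) → IsIntersectionNumber G θ →
    (v : ℕ) → IsIPOptimum r C θ v →
    (α : Fin r → ℕ) → FRep r C G α → v ≤ ∑ r α
proposition6 r C C≢[] _ G θ (_ , θ-minimal) v (_ , v-optimal) α rep =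
  v-optimal α (FRep.nonempty rep , θ≤gf)
  where
  θ≤gf : θ ≤ gf C α
  θ≤gf = θ-minimal (gf C α) (intRep-from-fRep C≢[] rep)
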